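{- For every $X\subseteq\mathbb{N}$, the Boolean frame $\mathfrak{C}_X$ does not have the congruence extension property.
   Context: An algebra has the congruence extension property (CEP) if for every subalgebra $B$ and every congruence $\Theta$ of $B$ there is a congruence $\Psi$ of the algebra with $\Psi\cap(B\times B)=\Theta$. Let $E=\{2n:n\in\mathbb{N}\}$, $O=\{2n+1:n\in\mathbb{N}\}$, and let $E^*$ be the set of infinite $S\subseteq\mathbb{N}$ such that $S\cap O$ is finite and $E\setminus S$ is finite. For $n\in\mathbb{N}$ write $\overline{n}=\{n\}$ and $-\overline{n}=\mathbb{N}\setminus\{n\}$. For $X\subseteq\mathbb{N}$, $\mathfrak{C}_X=\langle\mathcal{P}(\mathbb{N}),g\rangle$ is the powerset Boolean algebra of $\mathbb{N}$ with $g$ defined for $S\subseteq\mathbb{N}$ by: $g(S)=\{0,\dots,n\}$ if $S=\{0,\dots,n-1\}$ for some $n\in\mathbb{N}$; $g(S)=S$ if $S\in E^*$; $g(S)=-\overline{n}$ if $S=-\overline{n}$ and $n\in X$; $g(S)=S\cup\{\max(S)+1\}$ if $S$ is finite and $S\neq\{0,\dots,n-1\}$ for all $n\in\mathbb{N}$; and $g(S)=\mathbb{N}$ otherwise. -}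

module Defs where

open import Data.Bool using (Bool; true; false; _∧_; _∨_; not; if_then_else_)
open import Data.Nat using (ℕ; zero; suc; _≤_; _<_; _<ᵇ_; _≡ᵇ_)
open import Data.Nat.Properties using ()
open import Data.Product using (Σ; ∃; ∃-syntax; _×_; _,_; proj₁; proj₂)
open import Data.Empty using (⊥)
open import Relation.Nullary using (¬_)
open import Relation.Binary.PropositionalEquality using (_≡_)
open import Function.Bundles using (_⇔_)

Subset : Set
Subset = ℕ → Bool

infix 4 _≐_
_≐_ : Subset → Subset → Set
S ≐ T = ∀ k → S k ≡ T k

_⊓_ : Subset → Subset → Subset
(S ⊓ T) k = S k ∧ T k

_⊔_ : Subset → Subset → Subset
(S ⊔ T) k = S k ∨ T k

∁ : Subset → Subset
∁ S k = not (S k)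

∅ : Subset
∅ _ = false

full : Subset
full _ = true

seg : ℕ → Subset
seg n k = k <ᵇ n

single : ℕ → Subset
single n k = k ≡ᵇ n

co-single : ℕ → Subset
co-single n k = not (k ≡ᵇ n)

data Even : ℕ → Set where
  even0 : Even zero
  evenSS : ∀ {n} → Even n → Even (suc (suc n))

Odd : ℕ → Set
Odd n = Even (suc n)

Finite : Subset → Set
Finite S = ∃[ m ] (∀ k → m ≤ k → S k ≡ false)

Infinite : Subset → Set
Infinite S = ∀ m → ∃[ k ] (m ≤ k × S k ≡ true)

InEstar : Subset → Set
InEstar S = Infinite S
          × (∃[ m ] (∀ k → m ≤ k → Odd k → S k ≡ false))
          × (∃[ m ] (∀ k → m ≤ k → Even k → S k ≡ true))

IsSeg : Subset → Set
IsSeg S = ∃[ n ] (S ≐ seg n)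

IsMax : Subset → ℕ → Set
IsMax S m = S m ≡ true × (∀ k → m < k → S k ≡ false)

-- The operation g of 𝔆_X, specified clause by clause (X given by its
-- characteristic function).  Classically these clauses determine g
-- uniquely up to ≐.

record IsG (X : ℕ → Bool) (g : Subset → Subset) : Set where
  field
    g-resp : ∀ S T → S ≐ T → g S ≐ g T
    g-seg : ∀ S n → S ≐ seg n → g S ≐ seg (suc n)
    g-Estar : ∀ S → InEstar S → g S ≐ S
    g-cosingle : ∀ S n → X n ≡ true → S ≐ co-single n → g S ≐ co-single n
    g-finite : ∀ S m → Finite S → ¬ IsSeg S → IsMax S m →
               g S ≐ (S ⊔ single (suc m))
    g-other : ∀ S → ¬ IsSeg S → ¬ InEstar S →
              ¬ (∃[ n ] (X n ≡ true × S ≐ co-single n)) → ¬ Finite S →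
              g S ≐ full

record IsSubalgebra (g : Subset → Subset) (B : Subset → Set) : Set where
  field
    B-resp : ∀ {S T} → S ≐ T → B S → B T
    B-⊓ : ∀ {S T} → B S → B T → B (S ⊓ T)
    B-⊔ : ∀ {S T} → B S → B T → B (S ⊔ T)
    B-∁ : ∀ {S} → B S → B (∁ S)
    B-∅ : B ∅
    B-full : B full
    B-g : ∀ {S} → B S → B (g S)

record IsCongruence (g : Subset → Subset) (Ψ : Subset → Subset → Set) : Set where
  field
    c-refl : ∀ {S T} → S ≐ T → Ψ S T
    c-sym : ∀ {S T} → Ψ S T → Ψ T S
    c-trans : ∀ {S T U} → Ψ S T → Ψ T U → Ψ S U
    c-⊓ : ∀ {S S' T T'} → Ψ S S' → Ψ T T' → Ψ (S ⊓ T) (S' ⊓ T')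
    c-⊔ : ∀ {S S' T T'} → Ψ S S' → Ψ T T' → Ψ (S ⊔ T) (S' ⊔ T')
    c-∁ : ∀ {S S'} → Ψ S S' → Ψ (∁ S) (∁ S')
    c-g : ∀ {S S'} → Ψ S S' → Ψ (g S) (g S')

Elem : (Subset → Set) → Set
Elem B = Σ Subset B

record IsSubCongruence (g : Subset → Subset) (B : Subset → Set)
                       (sub : IsSubalgebra g B)
                       (Θ : Elem B → Elem B → Set) : Set where
  open IsSubalgebra sub
  field
    s-refl : ∀ {a b : Elem B} → proj₁ a ≐ proj₁ b → Θ a b
    s-sym : ∀ {a b} → Θ a b → Θ b a
    s-trans : ∀ {a b c} → Θ a b → Θ b c → Θ a c
    s-⊓ : ∀ {a a' b b'} → Θ a a' → Θ b b' →
          Θ (proj₁ a ⊓ proj₁ b , B-⊓ (proj₂ a) (proj₂ b))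
            (proj₁ a' ⊓ proj₁ b' , B-⊓ (proj₂ a') (proj₂ b'))
    s-⊔ : ∀ {a a' b b'} → Θ a a' → Θ b b' →
          Θ (proj₁ a ⊔ proj₁ b , B-⊔ (proj₂ a) (proj₂ b))
            (proj₁ a' ⊔ proj₁ b' , B-⊔ (proj₂ a') (proj₂ b'))
    s-∁ : ∀ {a a'} → Θ a a' →
          Θ (∁ (proj₁ a) , B-∁ (proj₂ a)) (∁ (proj₁ a') , B-∁ (proj₂ a'))
    s-g : ∀ {a a'} → Θ a a' →
          Θ (g (proj₁ a) , B-g (proj₂ a)) (g (proj₁ a') , B-g (proj₂ a'))

CEP : (Subset → Subset) → Set₁
CEP g = (B : Subset → Set) (sub : IsSubalgebra g B)
        (Θ : Elem B → Elem B → Set) → IsSubCongruence g B sub Θ →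
        ∃[ Ψ ] (IsCongruence g Ψ ×
                (∀ (a b : Elem B) → Ψ (proj₁ a) (proj₁ b) ⇔ Θ a b))

{-# OPTIONS --safe #-}

-- Let B be the eventually 2-periodic sets (from some point on constant on the even and on
-- the odd numbers) and Θ the relation "equal on all large odd numbers". g sends each kind
-- of such set (finite, cofinite, almost E, almost O) to one with the same odd tail, so B is
-- a subalgebra and Θ a congruence on it; Θ relates ∅ to E but not to ℕ. A congruence Ψ
-- extending Θ relates ∅ to every subset of E (meet both sides with it), in particular to
-- {0} and to the multiples of 4, and then g ∅ = {0} and g(4ℕ) = ℕ give ∅ Ψ ℕ.

module Submission where

open import Defs
open import Data.Bool using (Bool; true; false; _∧_; _∨_; not)
open import Data.Bool.Properties using (∧-zeroʳ)
open import Data.Nat using (ℕ; zero; suc; _+_; _≤_; _<_; _<ᵇ_; _≡ᵇ_; _≟_; z≤n; s≤s)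
open import Data.Nat.Properties using (≤-trans; m≤m+n; m≤n+m; m≤n⇒m≤1+n; ≤∧≢⇒<)
open import Data.Product using (∃; ∃₂; ∃-syntax; _×_; _,_; proj₂)
open import Data.Sum using (_⊎_; inj₁; inj₂)
import Data.Sum as Sum
open import Effect.Monad using (RawMonad)
open import Function.Base using (_∘_)
open import Function.Bundles using (Equivalence)
open import Level using (0ℓ)
open import Relation.Nullary using (¬_; Dec; yes; no)
open import Relation.Nullary.Decidable using (¬¬-excluded-middle)
open import Relation.Nullary.Negation using (DoubleNegation; ¬¬-Monad; contradiction)
open import Relation.Binary.PropositionalEquality using (_≡_; _≢_; refl; sym; trans; cong; cong₂)

open RawMonad (¬¬-Monad {0ℓ}) using (pure; _>>=_; _<$>_; zipWith)

variable
  S T U S′ T′ A C : Subset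
  b c p q p′ q′ : Bool
  n : ℕ
  P Q R : ℕ → Set

≡true⇒≢false : b ≡ true → b ≢ false
≡true⇒≢false refl ()

≐-sym : S ≐ T → T ≐ S
≐-sym S≐T k = sym (S≐T k)

<ᵇ-false : ∀ {k} → n ≤ k → (k <ᵇ n) ≡ false
<ᵇ-false {zero} _ = refl
<ᵇ-false {suc n} (s≤s n≤k) = <ᵇ-false n≤k

≡ᵇ-false : ∀ {k} → n < k → (k ≡ᵇ n) ≡ false
≡ᵇ-false {zero} (s≤s _) = refl
≡ᵇ-false {suc n} (s≤s n<k) = ≡ᵇ-false n<k

Eventually : (ℕ → Set) → Set
Eventually P = ∃[ m ] (∀ k → m ≤ k → P k)

Frequently : (ℕ → Set) → Set
Frequently P = ∀ m → ∃[ k ] (m ≤ k × P k)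

eventually-map : (∀ {k} → P k → Q k) → Eventually P → Eventually Q
eventually-map f (m , p) = m , λ k m≤k → f (p k m≤k)

eventually-zipWith : (∀ {k} → P k → Q k → R k) → Eventually P → Eventually Q → Eventually R
eventually-zipWith f (m , p) (n , q) =
  m + n , λ k m+n≤k → f (p k (≤-trans (m≤m+n m n) m+n≤k)) (q k (≤-trans (m≤n+m n m) m+n≤k))

frequently-map : (∀ {k} → P k → Q k) → Frequently P → Frequently Q
frequently-map f fr m with fr m
... | k , m≤k , pk = k , m≤k , f pk

frequently-∩-eventually : Frequently P → Eventually Q → Frequently (λ k → P k × Q k)
frequently-∩-eventually fr (m₀ , q) m with fr (m₀ + m)
... | k , m₀+m≤k , pk = k , ≤-trans (m≤n+m m m₀) m₀+m≤k , pk , q k (≤-trans (m≤m+n m₀ m) m₀+m≤k)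

frequently-∩-eventually-witness : Frequently P → Eventually Q → ∃[ k ] (P k × Q k)
frequently-∩-eventually-witness fr ev with frequently-∩-eventually fr ev 0
... | k , _ , pq = k , pq

eventually⇒frequently : Eventually P → Frequently P
eventually⇒frequently (m₀ , p) m = m₀ + m , m≤n+m m m₀ , p (m₀ + m) (m≤m+n m₀ m)

even-or-odd : ∀ k → Even k ⊎ Odd k
even-or-odd zero = inj₁ even0
even-or-odd (suc zero) = inj₂ (evenSS even0)
even-or-odd (suc (suc k)) = Sum.map evenSS evenSS (even-or-odd k)

frequently-even : Frequently Even
frequently-even zero = zero , z≤n , even0
frequently-even (suc m) with frequently-even m
... | k , m≤k , even-k = suc (suc k) , s≤s (m≤n⇒m≤1+n m≤k) , evenSS even-k

frequently-odd : Frequently Odd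
frequently-odd m with frequently-even m
... | k , m≤k , even-k = suc k , m≤n⇒m≤1+n m≤k , evenSS even-k

evens : Subset
evens zero = true
evens (suc zero) = false
evens (suc (suc k)) = evens k

evens-even : ∀ {k} → Even k → evens k ≡ true
evens-even even0 = refl
evens-even (evenSS e) = evens-even e

evens-odd : ∀ {k} → Odd k → evens k ≡ false
evens-odd {suc zero} _ = refl
evens-odd {suc (suc k)} (evenSS o) = evens-odd {k} o

multiplesOf4 : Subset
multiplesOf4 zero = true
multiplesOf4 (suc zero) = false
multiplesOf4 (suc (suc zero)) = false
multiplesOf4 (suc (suc (suc zero))) = false
multiplesOf4 (suc (suc (suc (suc k)))) = multiplesOf4 k

multiplesOf4-even : ∀ k → multiplesOf4 k ≡ true → Even k
multiplesOf4-even zero _ = even0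
multiplesOf4-even (suc (suc (suc (suc k)))) m = evenSS (evenSS (multiplesOf4-even k m))

multiplesOf4-gap : ∀ k → multiplesOf4 k ≡ true → multiplesOf4 (2 + k) ≡ false
multiplesOf4-gap zero _ = refl
multiplesOf4-gap (suc (suc (suc (suc k)))) m = multiplesOf4-gap k m

infinite-multiplesOf4 : Infinite multiplesOf4
infinite-multiplesOf4 zero = zero , z≤n , refl
infinite-multiplesOf4 (suc m) with infinite-multiplesOf4 m
... | k , m≤k , mk = 4 + k , s≤s (≤-trans m≤k (m≤n+m k 3)) , mk

multiplesOf4-evenGaps : Frequently (λ k → Even k × multiplesOf4 k ≡ false)
multiplesOf4-evenGaps m with infinite-multiplesOf4 m
... | k , m≤k , mk = 2 + k , ≤-trans m≤k (m≤n+m k 2) , evenSS (multiplesOf4-even k mk) , multiplesOf4-gap k mk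

Cofinite : Subset → Set
Cofinite S = Eventually (λ k → S k ≡ true)

EventuallyOn : (ℕ → Set) → Subset → Bool → Set
EventuallyOn P S b = Eventually (λ k → P k → S k ≡ b)

Alternating : Subset → Bool → Bool → Set
Alternating S p q = EventuallyOn Even S p × EventuallyOn Odd S q

EventuallyPeriodic : Subset → Set
EventuallyPeriodic S = ∃₂ (Alternating S)

OddTailsAgree : Subset → Subset → Set
OddTailsAgree S T = Eventually (λ k → Odd k → S k ≡ T k)

finite-resp : S ≐ T → Finite S → Finite T
finite-resp S≐T = eventually-map λ {k} Sk≡false → trans (sym (S≐T k)) Sk≡false

cofinite-resp : S ≐ T → Cofinite S → Cofinite T
cofinite-resp S≐T = eventually-map λ {k} Sk≡true → trans (sym (S≐T k)) Sk≡true

seg-finite : ∀ n → Finite (seg n)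
seg-finite n = n , λ _ → <ᵇ-false

single-finite : ∀ n → Finite (single n)
single-finite n = suc n , λ _ → ≡ᵇ-false

finite-⊔ : Finite S → Finite T → Finite (S ⊔ T)
finite-⊔ = eventually-zipWith (cong₂ _∨_)

co-single-cofinite : ∀ n → Cofinite (co-single n)
co-single-cofinite n = suc n , λ _ n<k → cong not (≡ᵇ-false n<k)

full-cofinite : Cofinite full
full-cofinite = zero , λ _ _ → refl

finite-max : ∀ m → (∀ k → m ≤ k → S k ≡ false) → (∀ k → S k ≡ false) ⊎ ∃ (IsMax S)
finite-max zero above = inj₁ (λ k → above k z≤n)
finite-max {S} (suc m) above with S m in Sm
... | true = inj₂ (m , Sm , above)
... | false = finite-max m above′
  where
  above′ : ∀ k → m ≤ k → S k ≡ false
  above′ k m≤k with m ≟ k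
  ... | yes refl = Sm
  ... | no m≢k = above k (≤∧≢⇒< m≤k m≢k)

infinite⇒¬finite : Infinite S → ¬ Finite S
infinite⇒¬finite inf fin with frequently-∩-eventually-witness inf fin
... | _ , Sk≡true , Sk≡false = ≡true⇒≢false Sk≡true Sk≡false

infinite⇒¬seg : Infinite S → ¬ IsSeg S
infinite⇒¬seg inf (n , S≐seg) = infinite⇒¬finite inf (finite-resp (≐-sym S≐seg) (seg-finite n))

oddMembers⇒¬InEstar : Frequently (λ k → Odd k × S k ≡ true) → ¬ InEstar S
oddMembers⇒¬InEstar fr (_ , oddTail , _) with frequently-∩-eventually-witness fr oddTail
... | _ , (odd-k , Sk≡true) , oddTail-k = ≡true⇒≢false Sk≡true (oddTail-k odd-k)

evenGaps⇒¬InEstar : Frequently (λ k → Even k × S k ≡ false) → ¬ InEstar S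
evenGaps⇒¬InEstar fr (_ , _ , evenTail) with frequently-∩-eventually-witness fr evenTail
... | _ , (even-k , Sk≡false) , evenTail-k = ≡true⇒≢false (evenTail-k even-k) Sk≡false

gaps⇒≉co-single : Frequently (λ k → S k ≡ false) → ¬ S ≐ co-single n
gaps⇒≉co-single {n = n} fr S≐co-single with frequently-∩-eventually-witness fr (co-single-cofinite n)
... | k , Sk≡false , co-single-k = ≡true⇒≢false (trans (S≐co-single k) co-single-k) Sk≡false

eventuallyOn⇒frequently : Frequently P → EventuallyOn P S b → Frequently (λ k → P k × S k ≡ b)
eventuallyOn⇒frequently fr ev = frequently-map (λ (pk , f) → pk , f pk) (frequently-∩-eventually fr ev)

alternating-resp : S ≐ T → Alternating S p q → Alternating T p q
alternating-resp {S} {T} S≐T (ev , od) = transport ev , transport od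
  where
  transport : EventuallyOn P S b → EventuallyOn P T b
  transport = eventually-map λ {k} f pk → trans (sym (S≐T k)) (f pk)

alternating-op₁ : (f : Bool → Bool) → Alternating S p q → Alternating (λ k → f (S k)) (f p) (f q)
alternating-op₁ f (ev , od) = lift ev , lift od
  where
  lift : EventuallyOn P S b → EventuallyOn P (λ k → f (S k)) (f b)
  lift = eventually-map λ e pk → cong f (e pk)

alternating-op₂ : (f : Bool → Bool → Bool) → Alternating S p q → Alternating T p′ q′ →
                  Alternating (λ k → f (S k) (T k)) (f p p′) (f q q′)
alternating-op₂ f (evS , odS) (evT , odT) = lift evS evT , lift odS odT
  where
  lift : EventuallyOn P S b → EventuallyOn P T c → EventuallyOn P (λ k → f (S k) (T k)) (f b c)
  lift = eventually-zipWith λ e e′ pk → cong₂ f (e pk) (e′ pk)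

constant⇒alternating : Eventually (λ k → S k ≡ b) → Alternating S b b
constant⇒alternating ev = eventually-map (λ e _ → e) ev , eventually-map (λ e _ → e) ev

alternating⇒constant : Alternating S b b → Eventually (λ k → S k ≡ b)
alternating⇒constant (ev , od) = eventually-zipWith (λ {k} e o → Sum.[ e , o ]′ (even-or-odd k)) ev od

alternating⇒InEstar : Alternating S true false → InEstar S
alternating⇒InEstar (ev , od) = frequently-map proj₂ (eventuallyOn⇒frequently frequently-even ev) , od , ev

evens-alternating : Alternating evens true false
evens-alternating = (zero , λ _ _ → evens-even) , (zero , λ _ _ → evens-odd)

oddValues⇒oddTailsAgree : EventuallyOn Odd S q → EventuallyOn Odd T q → OddTailsAgree S T
oddValues⇒oddTailsAgree = eventually-zipWith λ e e′ o → trans (e o) (sym (e′ o))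

oddTailsAgree-op₂ : (f : Bool → Bool → Bool) → OddTailsAgree S S′ → OddTailsAgree T T′ →
                    OddTailsAgree (λ k → f (S k) (T k)) (λ k → f (S′ k) (T′ k))
oddTailsAgree-op₂ f = eventually-zipWith λ e e′ o → cong₂ f (e o) (e′ o)

oddTailsAgree-trans : OddTailsAgree S T → OddTailsAgree T U → OddTailsAgree S U
oddTailsAgree-trans = eventually-zipWith λ e e′ o → trans (e o) (e′ o)

oddTailsAgree-sym : OddTailsAgree S T → OddTailsAgree T S
oddTailsAgree-sym = eventually-map λ e o → sym (e o)

oddTailsAgree-op₁ : (f : Bool → Bool) → OddTailsAgree S S′ → OddTailsAgree (λ k → f (S k)) (λ k → f (S′ k))
oddTailsAgree-op₁ f = eventually-map λ e o → cong f (e o)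

¬oddTailsAgree-∅-full : ¬ OddTailsAgree ∅ full
¬oddTailsAgree-∅-full (m , agree) with frequently-odd m
... | k , m≤k , odd-k with agree k m≤k odd-k
... | ()

-- Which clause of g applies is decidable only classically; a ¬¬-stable B is nevertheless
-- closed under g constructively.
Periodic : Subset → Set
Periodic S = DoubleNegation (EventuallyPeriodic S)

periodic-resp : S ≐ T → Periodic S → Periodic T
periodic-resp S≐T per = (λ (p , q , alt) → p , q , alternating-resp S≐T alt) <$> per

periodic-op₁ : (f : Bool → Bool) → Periodic S → Periodic (λ k → f (S k))
periodic-op₁ f per = (λ (p , q , alt) → f p , f q , alternating-op₁ f alt) <$> per

periodic-op₂ : (f : Bool → Bool → Bool) → Periodic S → Periodic T → Periodic (λ k → f (S k) (T k))
periodic-op₂ f = zipWith λ (p , q , alt) (p′ , q′ , alt′) → f p p′ , f q q′ , alternating-op₂ f alt alt′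

periodic-constant : ∀ b → Periodic (λ _ → b)
periodic-constant b = pure (b , b , constant⇒alternating (zero , λ _ _ → refl))

OddTails : {B : Subset → Set} → Elem B → Elem B → Set
OddTails (S , _) (T , _) = DoubleNegation (OddTailsAgree S T)

_⊆_ : Subset → Subset → Set
C ⊆ A = ∀ k → C k ≡ true → A k ≡ true

multiplesOf4⊆evens : multiplesOf4 ⊆ evens
multiplesOf4⊆evens k = evens-even ∘ multiplesOf4-even k

seg1⊆evens : seg 1 ⊆ evens
seg1⊆evens zero _ = refl
seg1⊆evens (suc _) ()

module _ {g : Subset → Subset} {Ψ : Subset → Subset → Set} (isCong : IsCongruence g Ψ) where
  open IsCongruence isCong

  ∅-⊆ : Ψ ∅ A → C ⊆ A → Ψ ∅ C
  ∅-⊆ {A} {C} ∅~A C⊆A = c-trans (c-⊓ ∅~A (c-refl {S = C} λ _ → refl)) (c-refl A⊓C≐C)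
    where
    A⊓C≐C : (A ⊓ C) ≐ C
    A⊓C≐C k with C k in Ck
    ... | true = cong (_∧ true) (C⊆A k Ck)
    ... | false = ∧-zeroʳ (A k)

module _ {X : ℕ → Bool} {g : Subset → Subset} (isG : IsG X g) where
  open IsG isG

  g≐full : Infinite S → ¬ InEstar S → ¬ (∃[ n ] (X n ≡ true × S ≐ co-single n)) → g S ≐ full
  g≐full {S} inf ¬InEstar ¬co-single = g-other S (infinite⇒¬seg inf) ¬InEstar ¬co-single (infinite⇒¬finite inf)

  g≐full-evenGaps : Infinite S → Frequently (λ k → Even k × S k ≡ false) → g S ≐ full
  g≐full-evenGaps inf evenGaps =
    g≐full inf (evenGaps⇒¬InEstar evenGaps) λ (_ , _ , S≐co-single) →
      gaps⇒≉co-single (frequently-map proj₂ evenGaps) S≐co-single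

  g-nonseg-finite : Finite S → ¬ IsSeg S → Finite (g S)
  g-nonseg-finite {S} fin@(m , above) ¬seg with finite-max m above
  ... | inj₁ empty = contradiction (zero , empty) ¬seg
  ... | inj₂ (max , isMax) =
    finite-resp (≐-sym (g-finite S max fin ¬seg isMax)) (finite-⊔ fin (single-finite (suc max)))

  g-preserves-finite : Finite S → DoubleNegation (Finite (g S))
  g-preserves-finite {S} fin = cases <$> ¬¬-excluded-middle
    where
    cases : Dec (IsSeg S) → Finite (g S)
    cases (yes (n , S≐seg)) = finite-resp (≐-sym (g-seg S n S≐seg)) (seg-finite (suc n))
    cases (no ¬seg) = g-nonseg-finite fin ¬seg

  g-preserves-cofinite : Cofinite S → DoubleNegation (Cofinite (g S))
  g-preserves-cofinite {S} cof = cases <$> ¬¬-excluded-middle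
    where
    cases : Dec (∃[ n ] (X n ≡ true × S ≐ co-single n)) → Cofinite (g S)
    cases (yes (n , Xn , S≐co-single)) =
      cofinite-resp (≐-sym (g-cosingle S n Xn S≐co-single)) (co-single-cofinite n)
    cases (no ¬co-single) = cofinite-resp (≐-sym (g≐full inf ¬InEstar ¬co-single)) full-cofinite
      where
      inf : Infinite S
      inf = eventually⇒frequently cof
      ¬InEstar : ¬ InEstar S
      ¬InEstar = oddMembers⇒¬InEstar (frequently-∩-eventually frequently-odd cof)

  g-alternating : Alternating S p q → DoubleNegation (∃[ p′ ] Alternating (g S) p′ q)
  g-alternating {p = false} {q = false} alt =
    (λ fin → false , constant⇒alternating fin) <$> g-preserves-finite (alternating⇒constant alt)
  g-alternating {p = true} {q = true} alt =
    (λ cof → true , constant⇒alternating cof) <$> g-preserves-cofinite (alternating⇒constant alt)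
  g-alternating {S} {p = true} {q = false} alt =
    pure (true , alternating-resp (≐-sym (g-Estar S (alternating⇒InEstar alt))) alt)
  g-alternating {S} {p = false} {q = true} (ev , od) =
    pure (true , alternating-resp (≐-sym (g≐full-evenGaps inf evenGaps)) (constant⇒alternating full-cofinite))
    where
    inf : Infinite S
    inf = frequently-map proj₂ (eventuallyOn⇒frequently frequently-odd od)
    evenGaps : Frequently (λ k → Even k × S k ≡ false)
    evenGaps = eventuallyOn⇒frequently frequently-even ev

  g-oddTailsAgree : Periodic S → DoubleNegation (OddTailsAgree (g S) S)
  g-oddTailsAgree per = do
    (_ , _ , alt) ← per
    (_ , alt-g) ← g-alternating alt
    pure (oddValues⇒oddTailsAgree (proj₂ alt-g) (proj₂ alt))

  periodic-subalgebra : IsSubalgebra g Periodic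
  periodic-subalgebra = record
    { B-resp = periodic-resp
    ; B-⊓ = periodic-op₂ _∧_
    ; B-⊔ = periodic-op₂ _∨_
    ; B-∁ = periodic-op₁ not
    ; B-∅ = periodic-constant false
    ; B-full = periodic-constant true
    ; B-g = λ per → do
        (_ , q , alt) ← per
        (p′ , alt-g) ← g-alternating alt
        pure (p′ , q , alt-g)
    }

  oddTails-subcongruence : IsSubCongruence g Periodic periodic-subalgebra OddTails
  oddTails-subcongruence = record
    { s-refl = λ S≐T → pure (zero , λ k _ _ → S≐T k)
    ; s-sym = oddTailsAgree-sym <$>_
    ; s-trans = zipWith oddTailsAgree-trans
    ; s-⊓ = zipWith (oddTailsAgree-op₂ _∧_)
    ; s-⊔ = zipWith (oddTailsAgree-op₂ _∨_)
    ; s-∁ = oddTailsAgree-op₁ not <$>_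
    ; s-g = λ {(_ , perS)} {(_ , perT)} S~T → do
        gS~S ← g-oddTailsAgree perS
        gT~T ← g-oddTailsAgree perT
        S~T ← S~T
        pure (oddTailsAgree-trans gS~S (oddTailsAgree-trans S~T (oddTailsAgree-sym gT~T)))
    }

  collapse : {Ψ : Subset → Subset → Set} → IsCongruence g Ψ → Ψ ∅ evens → Ψ ∅ full
  collapse {Ψ} isCong ∅~evens = c-trans ∅~seg1 (c-trans seg1~g∅ (c-trans (c-g ∅~M) (c-refl gM≐full)))
    where
    open IsCongruence isCong
    ∅~seg1 : Ψ ∅ (seg 1)
    ∅~seg1 = ∅-⊆ isCong ∅~evens seg1⊆evens
    seg1~g∅ : Ψ (seg 1) (g ∅)
    seg1~g∅ = c-refl (≐-sym (g-seg ∅ 0 λ _ → refl))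
    ∅~M : Ψ ∅ multiplesOf4
    ∅~M = ∅-⊆ isCong ∅~evens multiplesOf4⊆evens
    gM≐full : g multiplesOf4 ≐ full
    gM≐full = g≐full-evenGaps infinite-multiplesOf4 multiplesOf4-evenGaps

theorem2p8 : (X : ℕ → Bool) (g : Defs.Subset → Defs.Subset) → IsG X g → ¬ CEP g
theorem2p8 X g isG cep with cep Periodic (periodic-subalgebra isG) OddTails (oddTails-subcongruence isG)
... | Ψ , isCong , Ψ↾Periodic⇔OddTails =
  Equivalence.to (Ψ↾Periodic⇔OddTails ∅′ full′) ∅~full ¬oddTailsAgree-∅-full
  where
  ∅′ full′ evens′ : Elem Periodic
  ∅′ = ∅ , periodic-constant false
  full′ = full , periodic-constant true
  evens′ = evens , pure (true , false , evens-alternating)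
  ∅~evens : Ψ ∅ evens
  ∅~evens = Equivalence.from (Ψ↾Periodic⇔OddTails ∅′ evens′) (pure (zero , λ _ _ odd-k → sym (evens-odd odd-k)))
  ∅~full : Ψ ∅ full
  ∅~full = collapse isG isCong ∅~evens
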